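{- Let $\mathcal{M}=\{1^{m_1},\ldots,n^{m_n}\}$ with all $m_i\ge1$, $M=m_1+\cdots+m_n$ and $k=M-n+1$. There exist bijections $\psi_1:\mathcal{UT}_{\mathcal{M}}\to\mathcal{UG}_{\mathcal{M}}$ and $\psi_2:\mathcal{UG}_{\mathcal{M}}\to\mathcal{UB}_{n,k}$ such that, for every $T\in\mathcal{UT}_{\mathcal{M}}$, with $G=\psi_1(T)$ and $\Pi=\psi_2(G)=(\pi^{(0)},\ldots,\pi^{(k-1)})$, and for every $i\in\{0,1,\ldots,M-n\}$, the following three quantities are equal: the number of distinct labels among edges ending at the vertex labeled $i$ in $T$; the number of distinct labels among edges ending at the vertex labeled $i$ in $G$; and the number of integers in the block $\pi^{(i)}$.
   Context: Labeling conditions for a directed graph whose edges and vertices are labeled (an edge $u\to v$ "starts at $u$ and ends at $v$"; edges ending at a common vertex are sibling edges): (1) vertex labels are distinct and form exactly $\{0,1,\ldots,M-n\}\cup\{s_i:m_i=1\}$ ($s_i$ formal symbols); (2) a vertex has label $s_i$ iff it is a leaf (no incoming edges) whose outgoing edge has label $i$; (3) edge labels form exactly the multiset in which each $i$ with $m_i>1$ appears $m_i-1$ times and each $i$ with $m_i=1$ appears once, and equally labeled edges are sibling edges; (4) equally labeled edges have starting vertices whose labels increase along their order (in the unordered setting this just ties labels together), and for two edges with labels $e_1\ne e_2$ starting at integer-labeled vertices $v_1,v_2$, $e_1<e_2$ iff $v_1<v_2$. $\mathcal{UT}_{\mathcal{M}}$: unordered rooted trees with $M-\#\{i:m_i>1\}$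 edges, all edges directed toward the root, satisfying conditions (1)–(4), where the order among sibling edges is ignored. $\mathcal{UG}_{\mathcal{M}}$: directed graphs satisfying (1)–(4), with order among sibling edges ignored, in which the vertex labeled $0$ has outdegree $0$ and every other vertex has outdegree $1$ (loops and cycles allowed). $\mathcal{UB}_{n,k}$: $k$-tuples $(\pi^{(0)},\ldots,\pi^{(k-1)})$ of (possibly empty) subsets of $[n]$ forming a set partition of $[n]$. -}

module Defs where

open import Level using (0ℓ)
open import Data.Nat as ℕ using (ℕ; zero; suc; _+_; _∸_; _≤_)
open import Data.Nat.Properties using (≡-irrelevant)
open import Data.Fin as Fin using (Fin)
open import Data.Fin.Subset using (Subset; _∈_)
open import Data.List using (List; []; _∷_; map; _++_; filter; length; allFin)
open import Data.Nat.ListAction using (sum)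
open import Data.List.Relation.Unary.Any using (Any; any?)
open import Data.Maybe using (Maybe; nothing; just)
open import Data.Product using (Σ; ∃; _×_; _,_; proj₁; proj₂)
open import Data.Sum using (_⊎_; inj₁; inj₂)
open import Data.Empty using (⊥)
open import Relation.Nullary using (¬_; Dec; yes; no)
open import Relation.Binary using (DecidableEquality; Setoid; IsEquivalence)
open import Relation.Binary.PropositionalEquality using (_≡_; _≢_; refl; sym; trans; cong)
open import Function.Bundles using (_⇔_)
import Data.Maybe.Properties as MaybeP
import Data.Sum.Properties as SumP

-- The multiset M = {1^{m_1},...,n^{m_n}} is given by n and
-- m : Fin n → ℕ, where  m i  is the multiplicity of the label  i+1
-- (the paper's label j ∈ {1..n} is represented by the element j-1 of
-- Fin n; this preserves the order of labels).

totalM : (n : ℕ) → (Fin n → ℕ) → ℕ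
totalM n m = sum (map m (allFin n))

-- k = M - n + 1  (integer vertex labels are 0,...,M-n, i.e. Fin k)
kOf : (n : ℕ) → (Fin n → ℕ) → ℕ
kOf n m = suc (totalM n m ∸ n)

-- required number of edges with a given label, as a function of its
-- multiplicity: m-1 if m > 1, and 1 if m = 1.
reqCount : ℕ → ℕ
reqCount zero          = zero          -- never used (all m_i ≥ 1)
reqCount (suc zero)    = suc zero
reqCount (suc (suc x)) = suc x

module _ (n : ℕ) (m : Fin n → ℕ) where

  -- indices i with m_i = 1 (these carry a formal vertex label s_i)
  SymIdx : Set
  SymIdx = Σ (Fin n) (λ i → m i ≡ 1)

  Vtx : Set
  Vtx = Fin (kOf n m) ⊎ SymIdx

  -- A labelled digraph in which every vertex has outdegree ≤ 1, given by
  -- its out-map: out v = just (w , ℓ) means there is an edge v → w with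
  -- label ℓ; out v = nothing means v has outdegree 0.  (Since vertex
  -- labels are distinct and siblings are unordered, such a graph is
  -- exactly determined by this map.)
  Out : Set
  Out = Vtx → Maybe (Vtx × Fin n)

  Edge : Out → Vtx → Vtx → Fin n → Set
  Edge out v w ℓ = out v ≡ just (w , ℓ)

  IsLeaf : Out → Vtx → Set
  IsLeaf out v = ∀ u ℓ → ¬ Edge out u v ℓ

  symList : List (Fin n) → List SymIdx
  symList [] = []
  symList (i ∷ is) with m i ℕ.≟ 1
  ... | yes p = (i , p) ∷ symList is
  ... | no _  = symList is

  allVtx : List Vtx
  allVtx = map inj₁ (allFin (kOf n m)) ++ map inj₂ (symList (allFin n))

  _≟S_ : DecidableEquality SymIdx
  (i , p) ≟S (j , q) with i Fin.≟ j
  ... | yes refl = yes (cong (i ,_) (≡-irrelevant p q))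
  ... | no i≢j   = no (λ eq → i≢j (cong proj₁ eq))

  _≟V_ : DecidableEquality Vtx
  _≟V_ = SumP.≡-dec Fin._≟_ _≟S_

  _≟E_ : DecidableEquality (Vtx × Fin n)
  (v , ℓ) ≟E (w , ℓ') with v ≟V w | ℓ Fin.≟ ℓ'
  ... | yes refl | yes refl = yes refl
  ... | no v≢w   | _        = no (λ eq → v≢w (cong proj₁ eq))
  ... | yes _    | no ℓ≢ℓ'  = no (λ eq → ℓ≢ℓ' (cong proj₂ eq))

  _≟O_ : DecidableEquality (Maybe (Vtx × Fin n))
  _≟O_ = MaybeP.≡-dec _≟E_

  HasLabel : Fin n → Maybe (Vtx × Fin n) → Set
  HasLabel ℓ nothing         = ⊥
  HasLabel ℓ (just (_ , ℓ')) = ℓ' ≡ ℓ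

  hasLabel? : (ℓ : Fin n) (x : Maybe (Vtx × Fin n)) → Dec (HasLabel ℓ x)
  hasLabel? ℓ nothing         = no (λ ())
  hasLabel? ℓ (just (_ , ℓ')) = ℓ' Fin.≟ ℓ

  edgeCount : Out → Fin n → ℕ
  edgeCount out ℓ = length (filter (λ v → hasLabel? ℓ (out v)) allVtx)

  inLabelCount : Out → Vtx → ℕ
  inLabelCount out x =
    length (filter (λ ℓ → any? (λ v → out v ≟O just (x , ℓ)) allVtx) (allFin n))

  -- Labeling conditions (1)-(4).  (1) holds by construction of Vtx.
  record Labeling (out : Out) : Set where
    field
      cond2     : ∀ (v : Vtx) (i : SymIdx) →
                  (v ≡ inj₂ i) ⇔ (IsLeaf out v × ∃ λ w → Edge out v w (proj₁ i))
      cond3-cnt : ∀ ℓ → edgeCount out ℓ ≡ reqCount (m ℓ)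
      cond3-sib : ∀ v v' w w' ℓ → Edge out v w ℓ → Edge out v' w' ℓ → w ≡ w'
      cond4     : ∀ (a b : Fin (kOf n m)) w w' e₁ e₂ →
                  Edge out (inj₁ a) w e₁ → Edge out (inj₁ b) w' e₂ → e₁ ≢ e₂ →
                  (e₁ Fin.< e₂) ⇔ (a Fin.< b)

  data Reaches (out : Out) : Vtx → Set where
    here : ∀ {v} → out v ≡ nothing → Reaches out v
    step : ∀ {v w ℓ} → out v ≡ just (w , ℓ) → Reaches out w → Reaches out v

  -- rooted tree with all edges directed toward the root: exactly one
  -- vertex of outdegree 0 (the root), and every vertex reaches it
  IsRootedTree : Out → Set
  IsRootedTree out = (∀ v → Reaches out v)
                   × (∀ u v → out u ≡ nothing → out v ≡ nothing → u ≡ v)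

  IsUGGraph : Out → Set
  IsUGGraph out = (out (inj₁ Fin.zero) ≡ nothing)
                × (∀ v → v ≢ inj₁ Fin.zero → ∃ λ e → out v ≡ just e)

  _≈O_ : Out → Out → Set
  o₁ ≈O o₂ = ∀ v → o₁ v ≡ o₂ v

  ≈O-isEquivalence : IsEquivalence _≈O_
  ≈O-isEquivalence = record
    { refl  = λ v → refl
    ; sym   = λ p v → sym (p v)
    ; trans = λ p q v → trans (p v) (q v) }

  UT : Set
  UT = Σ Out (λ out → IsRootedTree out × Labeling out)

  UT-setoid : Setoid 0ℓ 0ℓ
  UT-setoid = record
    { Carrier = UT
    ; _≈_ = λ T₁ T₂ → proj₁ T₁ ≈O proj₁ T₂
    ; isEquivalence = record
        { refl  = IsEquivalence.refl ≈O-isEquivalence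
        ; sym   = IsEquivalence.sym ≈O-isEquivalence
        ; trans = IsEquivalence.trans ≈O-isEquivalence } }

  UG : Set
  UG = Σ Out (λ out → IsUGGraph out × Labeling out)

  UG-setoid : Setoid 0ℓ 0ℓ
  UG-setoid = record
    { Carrier = UG
    ; _≈_ = λ G₁ G₂ → proj₁ G₁ ≈O proj₁ G₂
    ; isEquivalence = record
        { refl  = IsEquivalence.refl ≈O-isEquivalence
        ; sym   = IsEquivalence.sym ≈O-isEquivalence
        ; trans = IsEquivalence.trans ≈O-isEquivalence } }

module _ (n k : ℕ) where

  IsSetPartition : (Fin k → Subset n) → Set
  IsSetPartition π = ∀ (j : Fin n) →
    (∃ λ b → j ∈ π b) × (∀ b b' → j ∈ π b → j ∈ π b' → b ≡ b')

  UB : Set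
  UB = Σ (Fin k → Subset n) IsSetPartition

  UB-setoid : Setoid 0ℓ 0ℓ
  UB-setoid = record
    { Carrier = UB
    ; _≈_ = λ Π₁ Π₂ → ∀ b → proj₁ Π₁ b ≡ proj₁ Π₂ b
    ; isEquivalence = record
        { refl  = λ b → refl
        ; sym   = λ p b → sym (p b)
        ; trans = λ p q b → trans (p b) (q b) } }

{-# OPTIONS --safe #-}
-- Condition (4) says that the labels on the outgoing edges of the non-root integer
-- vertices, read in increasing order of the vertices, form a sorted word, and (3) fixes
-- how often each label occurs in it; so this word is the unique sorted word
-- 1^(m₁-1) ⋯ n^(mₙ-1).  As equally labelled edges are siblings, a graph of 𝒰𝒯_M or 𝒰𝒢_M
-- is therefore determined by its root r and the map t sending each label to the common
-- end of the edges carrying it, and the number of labels entering vertex i is |t⁻¹(i)|.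
-- In 𝒰𝒢_M the root is 0 and t is arbitrary, so 𝒰𝒢_M ≅ [n] → [0, M-n] ≅ 𝒰ℬ_{n,k} via the
-- fibres of t.  In 𝒰𝒯_M the admissible pairs (r, t) are those for which iterating
-- ℓ ↦ (label of the edge leaving t(ℓ)) always stops at r.  A Prüfer code (repeatedly
-- delete the first label without children and record its target; the last entry is r)
-- maps these pairs bijectively onto [n] → [0, M-n], and since the code lists the values
-- of t in another order, the fibre sizes are unchanged.

module Submission where

open import Level using (0ℓ)
open import Data.Bool using (Bool; true; false; if_then_else_; _∧_)
open import Data.Bool.Properties using (∧-identityʳ; ∧-zeroʳ)
open import Data.Empty using (⊥-elim)
open import Data.Fin as Fin using (Fin; zero; suc; punchIn; punchOut; toℕ)
import Data.Fin.Properties as Fin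
open import Data.Fin.Subset using (Subset; ∣_∣) renaming (_∈_ to _∈ₛ_)
open import Data.List
  using (List; []; _∷_; _∷ʳ_; map; _++_; filter; length; allFin; tabulate; mapMaybe; initLast; _∷ʳ′_)
open import Data.List.Extrema.Nat using (argmax; argmax-sel; f[xs]≤f[argmax])
open import Data.List.Membership.Propositional using (_∈_; _∉_; find; lose)
open import Data.List.Membership.Propositional.Properties using (∈-filter⁺; ∈-filter⁻; ∈-map⁺; ∈-allFin)
open import Data.List.Membership.Propositional.Properties.WithK using (unique∧set⇒bag)
open import Data.List.Properties
  using (filter-all; filter-notAll; filter-++; filter-≐; ∷-injective; ∷ʳ-injectiveʳ;
         length-++; length-tabulate; length-map; map-tabulate; map-cong; map-cong-local; tabulate-cong)
open import Data.List.Relation.Binary.BagAndSetEquality using (∼bag⇒↭)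
open import Data.List.Relation.Binary.Permutation.Propositional.Properties using (filter-↭; ↭-length)
open import Data.List.Relation.Binary.Subset.Propositional using (_⊆_)
open import Data.List.Relation.Binary.Subset.Propositional.Properties using (Any-resp-⊆)
open import Data.List.Relation.Unary.All as All using (All; []; _∷_)
open import Data.List.Relation.Unary.AllPairs using ([]; _∷_)
open import Data.List.Relation.Unary.Any as Any using (Any; here; there; any?)
import Data.List.Relation.Unary.Any.Properties as Any
open import Data.List.Relation.Unary.Unique.Propositional using (Unique)
import Data.List.Relation.Unary.Unique.Propositional.Properties as Unique
open import Data.List.Relation.Unary.Unique.Propositional.Properties using (allFin⁺)
open import Data.Maybe as Maybe using (Maybe; just; nothing)
import Data.Maybe.Properties as Maybe
open import Data.Nat as ℕ using (ℕ; zero; suc; _+_; _∸_; _≤_; _<_; z≤n; s≤s)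
open import Data.Nat.ListAction using (sum)
open import Data.Nat.Properties as ℕ
  using (+-comm; +-identityʳ; +-cancelˡ-≡; +-∸-assoc; +-mono-≤; m≤n+m; ≤-trans; ≤-reflexive; <-≤-trans;
         ≤-pred;
         <⇒≤; <-irrefl; suc-injective; +-0-commutativeMonoid)
open import Algebra.Properties.CommutativeMonoid.Sum +-0-commutativeMonoid
  using (sum-cong-≗; sum-remove; sum-replicate-zero) renaming (sum to ∑)
open import Data.Product using (Σ; ∃; ∃₂; _×_; _,_; proj₁; proj₂)
open import Data.Product.Relation.Binary.Pointwise.NonDependent using (_×ₛ_)
open import Data.Sum using (_⊎_; inj₁; inj₂)
import Data.Sum.Properties as Sum
import Data.Vec as Vec
import Data.Vec.Properties as Vec
open import Function using (id; _∘_; _∘′_; case_of_)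
open import Function.Bundles using (_⇔_; mk⇔; Equivalence; Inverse; Bijection)
open import Function.Consequences.Setoid using (strictlyInverseˡ⇒inverseˡ; strictlyInverseʳ⇒inverseʳ)
import Function.Construct.Composition as Compose
import Function.Construct.Symmetry as Symmetry
open import Function.Properties.Inverse using (Inverse⇒Bijection)
open import Relation.Binary using (Setoid; _Preserves_⟶_)
import Relation.Binary.Construct.On as On
open import Relation.Binary.Definitions using (tri<; tri≈; tri>)
open import Relation.Binary.PropositionalEquality
open import Relation.Nullary using (Dec; yes; no; does; ¬_; ¬?; _×-dec_)
open import Relation.Nullary.Decidable using (dec-true; dec-false)
open import Relation.Unary using (Pred; Decidable)
open import Defs

-- Counting

bit : Bool → ℕ
bit b = if b then 1 else 0

count : ∀ {k} → (Fin k → Bool) → ℕ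
count f = ∑ (bit ∘ f)

count-cong : ∀ {k} {f g : Fin k → Bool} → f ≗ g → count f ≡ count g
count-cong f≗g = sum-cong-≗ (cong bit ∘ f≗g)

count-removeAt : ∀ {k} (i : Fin (suc k)) f → count f ≡ bit (f i) + count (f ∘ punchIn i)
count-removeAt i f = sum-remove (bit ∘ f)

count-none : ∀ {k} {f : Fin k → Bool} → (∀ j → f j ≡ false) → count f ≡ 0
count-none {k} none = trans (count-cong none) (sum-replicate-zero k)

count-pos : ∀ {k} (f : Fin k → Bool) j → f j ≡ true → 1 ≤ count f
count-pos f zero    fj rewrite fj = s≤s z≤n
count-pos f (suc j) fj = ≤-trans (count-pos (f ∘ suc) j fj) (m≤n+m _ (bit (f zero)))

length-filter-tabulate : ∀ {a p k} {A : Set a} {P : Pred A p} (P? : Decidable P) (g : Fin k → A) →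
  length (filter P? (tabulate g)) ≡ count (does ∘ P? ∘ g)
length-filter-tabulate {k = zero}  P? g = refl
length-filter-tabulate {k = suc k} P? g with does (P? (g zero))
... | true  = cong suc (length-filter-tabulate P? (g ∘ suc))
... | false = length-filter-tabulate P? (g ∘ suc)

length-filter-allFin : ∀ {p k} {P : Pred (Fin k) p} (P? : Decidable P) →
  length (filter P? (allFin k)) ≡ count (does ∘ P?)
length-filter-allFin P? = length-filter-tabulate P? id

∣tabulate∣≡count : ∀ {k} (f : Fin k → Bool) → ∣ Vec.tabulate f ∣ ≡ count f
∣tabulate∣≡count {zero}  f = refl
∣tabulate∣≡count {suc k} f with f zero
... | true  = cong suc (∣tabulate∣≡count (f ∘ suc))
... | false = ∣tabulate∣≡count (f ∘ suc)

count-only : ∀ {k} (i : Fin k) (g : Fin k → Bool) → count (λ j → does (j Fin.≟ i) ∧ g j) ≡ bit (g i)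
count-only {suc k} i g = begin
  count (λ j → does (j Fin.≟ i) ∧ g j)
    ≡⟨ count-removeAt i (λ j → does (j Fin.≟ i) ∧ g j) ⟩
  bit (does (i Fin.≟ i) ∧ g i) + count (λ j → does (punchIn i j Fin.≟ i) ∧ g (punchIn i j))
    ≡⟨ cong₂ (λ b c → bit (b ∧ g i) + c) (dec-true (i Fin.≟ i) refl) (count-none others-false) ⟩
  bit (g i) + 0
    ≡⟨ +-identityʳ _ ⟩
  bit (g i) ∎
  where
  open ≡-Reasoning
  others-false : ∀ j → does (punchIn i j Fin.≟ i) ∧ g (punchIn i j) ≡ false
  others-false j = cong (_∧ g (punchIn i j)) (dec-false (punchIn i j Fin.≟ i) (Fin.punchInᵢ≢i i j))

length-filter-map : ∀ {a b p} {A : Set a} {B : Set b} {P : Pred B p} (P? : Decidable P) (f : A → B) xs →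
  length (filter P? (map f xs)) ≡ length (filter (P? ∘ f) xs)
length-filter-map P? f []       = refl
length-filter-map P? f (x ∷ xs) with does (P? (f x))
... | true  = cong suc (length-filter-map P? f xs)
... | false = length-filter-map P? f xs

length-filter-∷ : ∀ {a p} {A : Set a} {P : Pred A p} (P? : Decidable P) x xs →
  length (filter P? (x ∷ xs)) ≡ bit (does (P? x)) + length (filter P? xs)
length-filter-∷ P? x xs with does (P? x)
... | true  = refl
... | false = refl

filter-nonempty : ∀ {a p} {A : Set a} {P : Pred A p} (P? : Decidable P) xs →
  1 ≤ length (filter P? xs) → ∃ λ x → x ∈ xs × P x
filter-nonempty P? xs 1≤ with filter P? xs in eq | 1≤
... | x ∷ _ | _ = x , ∈-filter⁻ P? (subst (x ∈_) (sym eq) (here refl))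

length-filter-enumeration : ∀ {n p} {P : Pred (Fin n) p} (P? : Decidable P) {ω : List (Fin n)} →
  Unique ω → (∀ x → x ∈ ω) → length (filter P? ω) ≡ length (filter P? (allFin n))
length-filter-enumeration {n} P? unique complete =
  ↭-length (filter-↭ P? (∼bag⇒↭ (unique∧set⇒bag unique (allFin⁺ n)
    (mk⇔ (λ _ → ∈-allFin _) (λ _ → complete _)))))

-- Sorted words

valueCount : ∀ {k n} → (Fin k → Fin n) → Fin n → ℕ
valueCount f y = count (λ x → does (f x Fin.≟ y))

valueCount-cong : ∀ {k n} {f g : Fin k → Fin n} → f ≗ g → ∀ y → valueCount f y ≡ valueCount g y
valueCount-cong f≗g y = count-cong λ x → cong (λ z → does (z Fin.≟ y)) (f≗g x)

Monotone : ∀ {k n} → (Fin k → Fin n) → Set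
Monotone f = f Preserves Fin._≤_ ⟶ Fin._≤_

valueCount-self : ∀ {k n} (f : Fin k → Fin n) j → 1 ≤ valueCount f (f j)
valueCount-self f j = count-pos _ j (dec-true (f j Fin.≟ f j) refl)

valueCount-<head : ∀ {k n} {g : Fin (suc k) → Fin n} → Monotone g →
  ∀ {y} → y Fin.< g zero → valueCount g y ≡ 0
valueCount-<head {g = g} mono-g y<g₀ =
  count-none λ j → dec-false (g j Fin.≟ _) λ gj≡y →
    Fin.<-irrefl (sym gj≡y) (<-≤-trans y<g₀ (mono-g {zero} {j} z≤n))

monotone-head : ∀ {k n} {f g : Fin (suc k) → Fin n} → Monotone g →
  (∀ y → valueCount f y ≡ valueCount g y) → ¬ f zero Fin.< g zero
monotone-head {f = f} mono-g same f₀<g₀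
  with () ← subst (1 ≤_) (trans (same (f zero)) (valueCount-<head mono-g f₀<g₀)) (valueCount-self f zero)

monotone-unique : ∀ {k n} {f g : Fin k → Fin n} → Monotone f → Monotone g →
  (∀ y → valueCount f y ≡ valueCount g y) → f ≗ g
monotone-unique {suc k} {f = f} {g} mono-f mono-g same = λ where
    zero    → head
    (suc j) → monotone-unique (mono-f ∘ s≤s) (mono-g ∘ s≤s) same-tail j
  where
  head : f zero ≡ g zero
  head with Fin.<-cmp (f zero) (g zero)
  ... | tri< f₀<g₀ _ _ = ⊥-elim (monotone-head {f = f} mono-g same f₀<g₀)
  ... | tri≈ _ f₀≡g₀ _ = f₀≡g₀
  ... | tri> _ _ g₀<f₀ = ⊥-elim (monotone-head {f = g} mono-f (sym ∘ same) g₀<f₀)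
  same-tail : ∀ y → valueCount (f ∘ suc) y ≡ valueCount (g ∘ suc) y
  same-tail y = +-cancelˡ-≡ (bit (does (f zero Fin.≟ y))) _ _
    (trans (same y) (cong (λ z → bit (does (z Fin.≟ y)) + _) (sym head)))

punchIn-< : ∀ {k} (r : Fin (suc k)) {i j : Fin k} → i Fin.< j → punchIn r i Fin.< punchIn r j
punchIn-< r {i} {j} i<j = Fin.≤∧≢⇒< (Fin.punchIn-mono-≤ r i j (<⇒≤ i<j))
                                    (λ eq → Fin.<-irrefl (Fin.punchIn-injective r i j eq) i<j)

SortedWord : ∀ {n} → (Fin n → ℕ) → ℕ → Set
SortedWord {n} m K = Σ (Fin K → Fin n) λ w → Monotone w × ∀ ℓ → valueCount w ℓ ≡ m ℓ ∸ 1

padZeros : ∀ {n K} a → (Fin K → Fin n) → Fin (a + K) → Fin (suc n)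
padZeros zero    w j       = suc (w j)
padZeros (suc a) w zero    = zero
padZeros (suc a) w (suc j) = padZeros a w j

padZeros-mono : ∀ {n K} a {w : Fin K → Fin n} → Monotone w → Monotone (padZeros a w)
padZeros-mono zero    mono-w           i≤j       = s≤s (mono-w i≤j)
padZeros-mono (suc a) mono-w {zero}    _         = z≤n
padZeros-mono (suc a) mono-w {suc i} {suc j} (s≤s i≤j) = padZeros-mono a mono-w i≤j

valueCount-padZeros-zero : ∀ {n K} a (w : Fin K → Fin n) → valueCount (padZeros a w) zero ≡ a
valueCount-padZeros-zero {K = K} zero w = count-none {K} {λ _ → false} λ _ → refl
valueCount-padZeros-zero (suc a) w = cong suc (valueCount-padZeros-zero a w)

valueCount-padZeros-suc : ∀ {n K} a (w : Fin K → Fin n) ℓ →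
  valueCount (padZeros a w) (suc ℓ) ≡ valueCount w ℓ
valueCount-padZeros-suc zero    w ℓ = refl
valueCount-padZeros-suc (suc a) w ℓ = valueCount-padZeros-suc a w ℓ

wordLength : ∀ n → (Fin n → ℕ) → ℕ
wordLength zero    m = 0
wordLength (suc n) m = (m zero ∸ 1) + wordLength n (m ∘ suc)

sortedWord-wordLength : ∀ n (m : Fin n → ℕ) → SortedWord m (wordLength n m)
sortedWord-wordLength zero    m = (λ ()) , (λ {}) , (λ ())
sortedWord-wordLength (suc n) m =
  let w , mono-w , counts-w = sortedWord-wordLength n (m ∘ suc) in
  padZeros (m zero ∸ 1) w , padZeros-mono (m zero ∸ 1) mono-w , λ where
    zero    → valueCount-padZeros-zero (m zero ∸ 1) w
    (suc ℓ) → trans (valueCount-padZeros-suc (m zero ∸ 1) w ℓ) (counts-w ℓ)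

totalM-suc : ∀ n (m : Fin (suc n) → ℕ) → totalM (suc n) m ≡ m zero + totalM n (m ∘ suc)
totalM-suc n m = cong (λ ms → m zero + sum ms)
  (trans (map-tabulate suc m) (sym (map-tabulate (λ i → i) (m ∘ suc))))

n≤totalM : ∀ n (m : Fin n → ℕ) → (∀ i → 1 ≤ m i) → n ≤ totalM n m
n≤totalM zero    m m≥1 = z≤n
n≤totalM (suc n) m m≥1 rewrite totalM-suc n m = +-mono-≤ (m≥1 zero) (n≤totalM n (m ∘ suc) (m≥1 ∘ suc))

wordLength≡totalM∸n : ∀ n (m : Fin n → ℕ) → (∀ i → 1 ≤ m i) → wordLength n m ≡ totalM n m ∸ n
wordLength≡totalM∸n zero    m m≥1 = refl
wordLength≡totalM∸n (suc n) m m≥1 rewrite totalM-suc n m with m zero | m≥1 zero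
... | suc a | s≤s _ = trans (cong (a +_) (wordLength≡totalM∸n n (m ∘ suc) (m≥1 ∘ suc)))
                           (sym (+-∸-assoc a (n≤totalM n (m ∘ suc) (m≥1 ∘ suc))))

sortedWord : ∀ n (m : Fin n → ℕ) → (∀ i → 1 ≤ m i) → SortedWord m (totalM n m ∸ n)
sortedWord n m m≥1 = subst (SortedWord m) (wordLength≡totalM∸n n m m≥1) (sortedWord-wordLength n m)

lookupOr : ∀ {a} {A : Set a} → A → List A → ℕ → A
lookupOr d []       i       = d
lookupOr d (x ∷ xs) zero    = x
lookupOr d (x ∷ xs) (suc i) = lookupOr d xs i

lookupOr-tabulate : ∀ {a} {A : Set a} (d : A) {k} (f : Fin k → A) i → lookupOr d (tabulate f) (Fin.toℕ i) ≡ f i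
lookupOr-tabulate d f zero    = refl
lookupOr-tabulate d f (suc i) = lookupOr-tabulate d (f ∘ suc) i

tabulate-lookupOr : ∀ {a} {A : Set a} (d : A) {k} (xs : List A) → length xs ≡ k →
  tabulate (λ (i : Fin k) → lookupOr d xs (Fin.toℕ i)) ≡ xs
tabulate-lookupOr d []       refl = refl
tabulate-lookupOr d (x ∷ xs) refl = cong (x ∷_) (tabulate-lookupOr d xs refl)

module _ {n : ℕ} where

  open import Data.List.Membership.DecPropositional (Fin._≟_ {n}) using (_∈?_)

  remove : Fin n → List (Fin n) → List (Fin n)
  remove x = filter (λ y → ¬? (y Fin.≟ x))

  ∈-remove⁺ : ∀ {x y S} → y ∈ S → y ≢ x → y ∈ remove x S
  ∈-remove⁺ {x} = ∈-filter⁺ (λ y → ¬? (y Fin.≟ x))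

  ∈-remove⁻ : ∀ {x y S} → y ∈ remove x S → y ∈ S × y ≢ x
  ∈-remove⁻ {x} = ∈-filter⁻ (λ y → ¬? (y Fin.≟ x))

  remove-unique : ∀ {x S} → Unique S → Unique (remove x S)
  remove-unique {x} = Unique.filter⁺ (λ y → ¬? (y Fin.≟ x))

  ∉⇒All≢ : ∀ {x} {S : List (Fin n)} → x ∉ S → All (_≢ x) S
  ∉⇒All≢ {S = []}    x∉S = []
  ∉⇒All≢ {S = y ∷ S} x∉S = (λ y≡x → x∉S (here (sym y≡x))) ∷ ∉⇒All≢ (x∉S ∘′ there)

  All≢⇒∉ : ∀ {x} {S : List (Fin n)} → All (x ≢_) S → x ∉ S
  All≢⇒∉ (x≢y ∷ _)   (here x≡y) = x≢y x≡y
  All≢⇒∉ (_ ∷ x≢S)   (there x∈S) = All≢⇒∉ x≢S x∈S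

  length-remove : ∀ {x S} → Unique S → x ∈ S → suc (length (remove x S)) ≡ length S
  length-remove {x} {x ∷ S} (x∉S ∷ _) (here refl) with x Fin.≟ x
  ... | yes _   = cong (suc ∘′ length) (filter-all (λ y → ¬? (y Fin.≟ x)) (∉⇒All≢ (All≢⇒∉ x∉S)))
  ... | no x≢x = ⊥-elim (x≢x refl)
  length-remove {x} {y ∷ S} (y∉S ∷ u) (there x∈S) with y Fin.≟ x
  ... | yes refl = ⊥-elim (All≢⇒∉ y∉S x∈S)
  ... | no _     = cong suc (length-remove u x∈S)

  pigeonhole : ∀ (S O : List (Fin n)) → Unique S → length O < length S → ∃ λ x → x ∈ S × x ∉ O
  pigeonhole (x ∷ S) O (x∉S ∷ u) |O|<|S| with x ∈? O
  ... | no x∉O = x , here refl , x∉O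
  ... | yes x∈O with pigeonhole S (remove x O) u
        (<-≤-trans (filter-notAll (λ y → ¬? (y Fin.≟ x)) O (Any.map (λ { refl ¬x≡x → ¬x≡x refl }) x∈O))
                   (≤-pred |O|<|S|))
  ...   | y , y∈S , y∉O∖x =
    y , there y∈S , λ y∈O → y∉O∖x (∈-remove⁺ y∈O λ { refl → All≢⇒∉ x∉S y∈S })

module _ {n : ℕ} {V : Set} where

  assoc : List (Fin n) → List V → V → Fin n → V
  assoc []      cs       default x = default
  assoc (y ∷ ω) []       default x = default
  assoc (y ∷ ω) (c ∷ cs) default x with y Fin.≟ x
  ... | yes _ = c
  ... | no  _ = assoc ω cs default x

  assoc-head : ∀ y ω c cs default → assoc (y ∷ ω) (c ∷ cs) default y ≡ c
  assoc-head y ω c cs default with y Fin.≟ y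
  ... | yes _   = refl
  ... | no y≢y = ⊥-elim (y≢y refl)

  assoc-tail : ∀ y ω c cs default {x} → y ≢ x → assoc (y ∷ ω) (c ∷ cs) default x ≡ assoc ω cs default x
  assoc-tail y ω c cs default {x} y≢x with y Fin.≟ x
  ... | yes y≡x = ⊥-elim (y≢x y≡x)
  ... | no  _   = refl

  map-assoc : ∀ ω cs default → Unique ω → length ω ≡ length cs → map (assoc ω cs default) ω ≡ cs
  map-assoc []      []       default _           _      = refl
  map-assoc (y ∷ ω) (c ∷ cs) default (y∉ω ∷ u) |ω|≡|cs| = cong₂ _∷_ (assoc-head y ω c cs default)
    (trans (map-cong-local (All.map (assoc-tail y ω c cs default) y∉ω))
           (map-assoc ω cs default u (suc-injective |ω|≡|cs|)))

  assoc-map : ∀ (t : Fin n → V) ω default → Unique ω → ∀ {x} → x ∈ ω → assoc ω (map t ω) default x ≡ t x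
  assoc-map t (y ∷ ω) default u       (here refl) = assoc-head y ω (t y) (map t ω) default
  assoc-map t (y ∷ ω) default (y∉ω ∷ u) (there x∈ω) =
    trans (assoc-tail y ω (t y) (map t ω) default (All.lookup y∉ω x∈ω)) (assoc-map t ω default u x∈ω)

SameElements : ∀ {a} {A : Set a} → List A → List A → Set a
SameElements xs ys = xs ⊆ ys × ys ⊆ xs

-- Prüfer codes

-- label v is the label of the edge leaving the vertex v (nothing at a root).  A map
-- t from labels to vertices turns the labels into a forest: the parent of x is label (t x).
module Prüfer {n : ℕ} {V : Set} (label : V → Maybe (Fin n)) where

  Carries : Fin n → V → Set
  Carries x c = label c ≡ just x

  Childless : List V → Fin n → Set
  Childless cs x = ¬ Any (Carries x) cs

  childless? : ∀ cs x → Dec (Childless cs x)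
  childless? cs x = ¬? (any? (λ c → Maybe.≡-dec Fin._≟_ (label c) (just x)) cs)

  firstChildless : List (Fin n) → List V → Maybe (Fin n)
  firstChildless []      cs = nothing
  firstChildless (x ∷ S) cs with childless? cs x
  ... | yes _ = just x
  ... | no  _ = firstChildless S cs

  firstChildless-cong : ∀ S {cs cs′} → (∀ x → Any (Carries x) cs → Any (Carries x) cs′) →
    (∀ x → Any (Carries x) cs′ → Any (Carries x) cs) → firstChildless S cs ≡ firstChildless S cs′
  firstChildless-cong []      to from = refl
  firstChildless-cong (x ∷ S) {cs} {cs′} to from with childless? cs x | childless? cs′ x
  ... | yes _ | yes _ = refl
  ... | no  _ | no  _ = firstChildless-cong S to from
  ... | yes ¬c | no ¬¬c′ = ⊥-elim (¬¬c′ (¬c ∘ from x))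
  ... | no ¬¬c | yes ¬c′ = ⊥-elim (¬¬c (¬c′ ∘ to x))

  firstChildless-sound : ∀ S cs {x} → firstChildless S cs ≡ just x → x ∈ S × Childless cs x
  firstChildless-sound (y ∷ S) cs eq with childless? cs y | eq
  ... | yes ¬c | refl = here refl , ¬c
  ... | no  _  | eq′  = let x∈S , ¬c = firstChildless-sound S cs eq′ in there x∈S , ¬c

  firstChildless-complete : ∀ S cs {x} → x ∈ S → Childless cs x → ∃ λ y → firstChildless S cs ≡ just y
  firstChildless-complete (y ∷ S) cs x∈ ¬c with childless? cs y | x∈
  ... | yes _  | _          = y , refl
  ... | no ¬¬c | here refl  = ⊥-elim (¬¬c ¬c)
  ... | no _   | there x∈S  = firstChildless-complete S cs x∈S ¬c

  EndsAtRoot : List V → Set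
  EndsAtRoot cs = cs ≡ [] ⊎ ∃₂ λ init c → cs ≡ init ∷ʳ c × label c ≡ nothing

  ∈-mapMaybe⁺ : ∀ {x} cs → Any (Carries x) cs → x ∈ mapMaybe label cs
  ∈-mapMaybe⁺ (c ∷ cs) (here carries) with label c | carries
  ... | just y | refl = here refl
  ∈-mapMaybe⁺ (c ∷ cs) (there c∈) with label c
  ... | just y  = there (∈-mapMaybe⁺ cs c∈)
  ... | nothing = ∈-mapMaybe⁺ cs c∈

  length-mapMaybe-∷ʳroot : ∀ init c → label c ≡ nothing → length (mapMaybe label (init ∷ʳ c)) ≤ length init
  length-mapMaybe-∷ʳroot []         c root with label c | root
  ... | nothing | refl = z≤n
  length-mapMaybe-∷ʳroot (c′ ∷ init) c root with label c′
  ... | just _  = s≤s (length-mapMaybe-∷ʳroot init c root)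
  ... | nothing = ℕ.m≤n⇒m≤1+n (length-mapMaybe-∷ʳroot init c root)

  mutual
    decode : List (Fin n) → List V → List (Fin n)
    decode S []       = []
    decode S (c ∷ cs) = decodeStep S cs (firstChildless S (c ∷ cs))

    decodeStep : List (Fin n) → List V → Maybe (Fin n) → List (Fin n)
    decodeStep S cs nothing  = []
    decodeStep S cs (just x) = x ∷ decode (remove x S) cs

  decode-∷ : ∀ S c cs {x} → firstChildless S (c ∷ cs) ≡ just x →
    decode S (c ∷ cs) ≡ x ∷ decode (remove x S) cs
  decode-∷ S c cs eq = cong (decodeStep S cs) eq

  record ValidCode (S : List (Fin n)) (cs : List V) : Set where
    field
      unique     : Unique S
      length≡    : length cs ≡ length S
      endsAtRoot : EndsAtRoot cs
      labels∈    : ∀ {c y} → c ∈ cs → label c ≡ just y → y ∈ S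

  validCode-childless : ∀ S c cs → ValidCode S (c ∷ cs) → ∃ λ x → firstChildless S (c ∷ cs) ≡ just x
  validCode-childless S c cs valid with ValidCode.endsAtRoot valid
  ... | inj₂ (init , root , c∷cs≡ , root-label) =
    let x , x∈S , x∉labels = pigeonhole S (mapMaybe label (c ∷ cs)) (ValidCode.unique valid) |labels|<|S|
    in firstChildless-complete S (c ∷ cs) x∈S (x∉labels ∘ ∈-mapMaybe⁺ (c ∷ cs))
    where
    |labels|<|S| : length (mapMaybe label (c ∷ cs)) < length S
    |labels|<|S| = begin-strict
      length (mapMaybe label (c ∷ cs))     ≡⟨ cong (length ∘ mapMaybe label) c∷cs≡ ⟩
      length (mapMaybe label (init ∷ʳ root)) ≤⟨ length-mapMaybe-∷ʳroot init root root-label ⟩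
      length init                          <⟨ ℕ.n<1+n _ ⟩
      suc (length init)                    ≡⟨ trans (+-comm 1 _) (sym (length-++ init)) ⟩
      length (init ∷ʳ root)                ≡⟨ cong length c∷cs≡ ⟨
      length (c ∷ cs)                      ≡⟨ ValidCode.length≡ valid ⟩
      length S                             ∎
      where open ℕ.≤-Reasoning

  validCode-step : ∀ S c cs {x} → ValidCode S (c ∷ cs) → firstChildless S (c ∷ cs) ≡ just x →
    ValidCode (remove x S) cs
  validCode-step S c cs {x} valid first = record
    { unique     = remove-unique unique
    ; length≡    = suc-injective (trans length≡ (sym (length-remove unique x∈S)))
    ; endsAtRoot = endsAtRoot′ endsAtRoot
    ; labels∈    = λ c′∈ carries → ∈-remove⁺ (labels∈ (there c′∈) carries)
                                     λ { refl → ¬child (there (lose c′∈ carries)) }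
    }
    where
    open ValidCode valid
    x∈S = proj₁ (firstChildless-sound S (c ∷ cs) first)
    ¬child = proj₂ (firstChildless-sound S (c ∷ cs) first)
    endsAtRoot′ : EndsAtRoot (c ∷ cs) → EndsAtRoot cs
    endsAtRoot′ (inj₂ ([]        , root , refl , root-label)) = inj₁ refl
    endsAtRoot′ (inj₂ (_ ∷ init , root , refl , root-label)) = inj₂ (init , root , refl , root-label)

  sameElements-∷ : ∀ {x : Fin n} {S ω} → x ∈ S → SameElements ω (remove x S) → SameElements (x ∷ ω) S
  sameElements-∷ {x} {S} x∈S (ω⊆ , ⊆ω) =
      (λ { (here refl) → x∈S ; (there z∈ω) → proj₁ (∈-remove⁻ {S = S} (ω⊆ z∈ω)) })
    , λ {z} z∈S → case z Fin.≟ x of λ where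
        (yes refl) → here refl
        (no z≢x)   → there (⊆ω (∈-remove⁺ z∈S z≢x))

  unique-∷ : ∀ {x : Fin n} {S ω} → SameElements ω (remove x S) → Unique ω → Unique (x ∷ ω)
  unique-∷ {S = S} (ω⊆ , _) u =
    All.tabulate (λ z∈ω z≡x → proj₂ (∈-remove⁻ {S = S} (ω⊆ z∈ω)) (sym z≡x)) ∷ u

  record Enumerates (S : List (Fin n)) (ω : List (Fin n)) : Set where
    field
      sameElements : SameElements ω S
      unique       : Unique ω
      length≡      : length ω ≡ length S

  decode-enumerates : ∀ S cs → ValidCode S cs → Enumerates S (decode S cs)
  decode-enumerates S [] valid with S | ValidCode.length≡ valid
  ... | [] | refl = record { sameElements = (λ ()) , (λ ()) ; unique = [] ; length≡ = refl }
  decode-enumerates S (c ∷ cs) valid with validCode-childless S c cs valid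
  ... | x , first rewrite decode-∷ S c cs first =
    let open Enumerates (decode-enumerates (remove x S) cs (validCode-step S c cs valid first)) in
    record
      { sameElements = sameElements-∷ (proj₁ (firstChildless-sound S (c ∷ cs) first)) sameElements
      ; unique       = unique-∷ {S = S} sameElements unique
      ; length≡      = trans (cong suc length≡)
                             (length-remove (ValidCode.unique valid) (proj₁ (firstChildless-sound S (c ∷ cs) first)))
      }

  module Tree (t : Fin n → V) where

    data ReachesRoot : Fin n → Set where
      root : ∀ {x}   → label (t x) ≡ nothing → ReachesRoot x
      up   : ∀ {x y} → label (t x) ≡ just y → ReachesRoot y → ReachesRoot x

    depth : ∀ {x} → ReachesRoot x → ℕ
    depth (root _)  = 0
    depth (up _ r)  = suc (depth r)

    depth-unique : ∀ {x} (p q : ReachesRoot x) → depth p ≡ depth q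
    depth-unique (root _)   (root _)    = refl
    depth-unique (root ≡n)  (up ≡j _)   with () ← trans (sym ≡n) ≡j
    depth-unique (up ≡j _)  (root ≡n)   with () ← trans (sym ≡n) ≡j
    depth-unique (up ≡j p)  (up ≡j′ q)  with refl ← trans (sym ≡j) ≡j′ = cong suc (depth-unique p q)

    decode-reachesRoot : ∀ S cs → ValidCode S cs → map t (decode S cs) ≡ cs →
      ∀ {x} → x ∈ decode S cs → ReachesRoot x
    decode-reachesRoot S (c ∷ cs) valid t∘decode≡ {z} z∈ with validCode-childless S c cs valid
    ... | x , first rewrite decode-∷ S c cs first = go t∘decode≡ z∈
      where
      valid′ = validCode-step S c cs valid first
      go : t x ∷ map t (decode (remove x S) cs) ≡ c ∷ cs → z ∈ x ∷ decode (remove x S) cs → ReachesRoot z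
      go eq (there z∈′) = decode-reachesRoot (remove x S) cs valid′ (proj₂ (∷-injective eq)) z∈′
      go eq (here refl) with label (t x) in label-tx
      ... | nothing = root label-tx
      ... | just y  = up label-tx (decode-reachesRoot (remove x S) cs valid′ (proj₂ (∷-injective eq)) y∈decode)
        where
        carries : label c ≡ just y
        carries = trans (cong label (sym (proj₁ (∷-injective eq)))) label-tx
        y∈S∖x : y ∈ remove x S
        y∈S∖x = ∈-remove⁺ (ValidCode.labels∈ valid (here refl) carries)
                  λ { refl → proj₂ (firstChildless-sound S (c ∷ cs) first) (here carries) }
        y∈decode : y ∈ decode (remove x S) cs
        y∈decode = proj₂ (Enumerates.sameElements (decode-enumerates (remove x S) cs valid′)) y∈S∖x

    ParentClosed : List (Fin n) → Set
    ParentClosed S = ∀ {x y} → x ∈ S → label (t x) ≡ just y → y ∈ S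

    -- The fuel only has to bound the length of the list of labels.
    mutual
      encode : ℕ → List (Fin n) → List (Fin n)
      encode zero     S = []
      encode (suc f) S = encodeStep f S (firstChildless S (map t S))

      encodeStep : ℕ → List (Fin n) → Maybe (Fin n) → List (Fin n)
      encodeStep f S nothing  = []
      encodeStep f S (just x) = x ∷ encode f (remove x S)

    encode-∷ : ∀ f S {x} → firstChildless S (map t S) ≡ just x → encode (suc f) S ≡ x ∷ encode f (remove x S)
    encode-∷ f S first = cong (encodeStep f S) first

    encode-[] : ∀ f → encode f [] ≡ []
    encode-[] zero    = refl
    encode-[] (suc f) = refl

    carried-resp : ∀ {xs ys z} → xs ⊆ ys → Any (Carries z) (map t xs) → Any (Carries z) (map t ys)
    carried-resp xs⊆ys = Any.map⁺ ∘ Any-resp-⊆ xs⊆ys ∘ Any.map⁻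

    firstChildless-same : ∀ S {xs ys} → SameElements xs ys →
      firstChildless S (map t xs) ≡ firstChildless S (map t ys)
    firstChildless-same S (xs⊆ys , ys⊆xs) =
      firstChildless-cong S (λ _ → carried-resp xs⊆ys) (λ _ → carried-resp ys⊆xs)

    encode-decode : ∀ S cs → ValidCode S cs → map t (decode S cs) ≡ cs →
      ∀ f → length S ≤ f → encode f S ≡ decode S cs
    encode-decode S [] valid _ f _ with S | ValidCode.length≡ valid
    ... | [] | refl = encode-[] f
    encode-decode S (c ∷ cs) valid _ zero |S|≤0 with S | ValidCode.length≡ valid | |S|≤0
    ... | _ ∷ _ | _ | ()
    encode-decode S (c ∷ cs) valid t∘decode≡ (suc f) |S|≤1+f with validCode-childless S c cs valid
    ... | x , first rewrite decode-∷ S c cs first =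
        trans (encode-∷ f S first′)
              (cong (x ∷_) (encode-decode (remove x S) cs valid′ (proj₂ (∷-injective t∘decode≡)) f |S∖x|≤f))
      where
      valid′ = validCode-step S c cs valid first
      x∈S = proj₁ (firstChildless-sound S (c ∷ cs) first)
      same : SameElements (x ∷ decode (remove x S) cs) S
      same = sameElements-∷ x∈S (Enumerates.sameElements (decode-enumerates (remove x S) cs valid′))
      first′ : firstChildless S (map t S) ≡ just x
      first′ = trans (firstChildless-same S (proj₂ same , proj₁ same))
                     (trans (cong (firstChildless S) t∘decode≡) first)
      |S∖x|≤f : length (remove x S) ≤ f
      |S∖x|≤f = ≤-pred (≤-trans (≤-reflexive (length-remove (ValidCode.unique valid) x∈S)) |S|≤1+f)

    record EncodesTree (S ω : List (Fin n)) : Set where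
      field
        enumerates   : Enumerates S ω
        decode-code  : decode S (map t ω) ≡ ω
        endsAtRoot   : EndsAtRoot (map t ω)

    module _ (reachesRoot : ∀ x → ReachesRoot x) where

      height : Fin n → ℕ
      height x = depth (reachesRoot x)

      height-up : ∀ {x y} → label (t y) ≡ just x → height y ≡ suc (height x)
      height-up {x} {y} carries = depth-unique (reachesRoot y) (up carries (reachesRoot x))

      childless-exists : ∀ S {x₀} → x₀ ∈ S → ∃ λ x → x ∈ S × Childless (map t S) x
      childless-exists S {x₀} x₀∈S = deepest , deepest∈S , λ carried →
          let y , y∈S , carries = find (Any.map⁻ carried)
          in <-irrefl refl (≤-trans (≤-reflexive (sym (height-up carries)))
                                    (All.lookup (f[xs]≤f[argmax] {f = height} x₀ S) y∈S))
        where
        deepest = argmax height x₀ S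
        deepest∈S : deepest ∈ S
        deepest∈S with argmax-sel height x₀ S
        ... | inj₁ ≡x₀  = subst (_∈ S) (sym ≡x₀) x₀∈S
        ... | inj₂ ∈S   = ∈S

      encodesTree-∷ : ∀ {S x ω} → Unique S → ParentClosed S → firstChildless S (map t S) ≡ just x →
        EncodesTree (remove x S) ω → EncodesTree S (x ∷ ω)
      encodesTree-∷ {S} {x} {ω} unique closed first IH = record
        { enumerates  = record { sameElements = same ; unique = unique-∷ {S = S} ω-same ω-unique
                               ; length≡ = trans (cong suc ω-length) (length-remove unique x∈S) }
        ; decode-code = trans (decode-∷ S (t x) (map t ω) first′) (cong (x ∷_) (EncodesTree.decode-code IH))
        ; endsAtRoot  = endsAtRoot′ (EncodesTree.endsAtRoot IH)
        }
        where
        x∈S = proj₁ (firstChildless-sound S (map t S) first)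
        x-childless = proj₂ (firstChildless-sound S (map t S) first)
        open Enumerates (EncodesTree.enumerates IH)
          renaming (sameElements to ω-same; unique to ω-unique; length≡ to ω-length)
        same : SameElements (x ∷ ω) S
        same = sameElements-∷ x∈S ω-same
        first′ : firstChildless S (map t (x ∷ ω)) ≡ just x
        first′ = trans (firstChildless-same S same) first
        endsAtRoot′ : EndsAtRoot (map t ω) → EndsAtRoot (t x ∷ map t ω)
        endsAtRoot′ (inj₂ (init , c , eq , root-label)) = inj₂ (t x ∷ init , c , cong (t x ∷_) eq , root-label)
        endsAtRoot′ (inj₁ tω≡[]) with label (t x) in label-tx
        ... | nothing = inj₂ ([] , t x , cong (t x ∷_) tω≡[] , label-tx)
        ... | just z with z Fin.≟ x
        ...   | yes refl = ⊥-elim (x-childless (Any.map⁺ (lose x∈S label-tx)))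
        ...   | no z≢x   with () ← subst (t z ∈_) tω≡[]
                                    (∈-map⁺ t (proj₂ ω-same (∈-remove⁺ (closed x∈S label-tx) z≢x)))

      firstChildless-nothing : ∀ S → firstChildless S (map t S) ≡ nothing → S ≡ []
      firstChildless-nothing []      _    = refl
      firstChildless-nothing S@(_ ∷ _) none =
        let x , x∈S , x-childless = childless-exists S (here refl)
            _ , some = firstChildless-complete S (map t S) x∈S x-childless
        in case trans (sym some) none of λ ()

      encodesTree-[] : EncodesTree [] []
      encodesTree-[] = record
        { enumerates = record { sameElements = (λ ()) , (λ ()) ; unique = [] ; length≡ = refl }
        ; decode-code = refl ; endsAtRoot = inj₁ refl }

      encode-encodesTree : ∀ f S → Unique S → ParentClosed S → length S ≤ f → EncodesTree S (encode f S)
      encode-encodesTree zero    []      _      _      _ = encodesTree-[]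
      encode-encodesTree (suc f) S unique closed |S|≤1+f with firstChildless S (map t S) in first
      ... | just x = encodesTree-∷ unique closed first
          (encode-encodesTree f (remove x S) (remove-unique unique) closed′
             (≤-pred (≤-trans (≤-reflexive (length-remove unique x∈S)) |S|≤1+f)))
        where
        x∈S = proj₁ (firstChildless-sound S (map t S) first)
        closed′ : ParentClosed (remove x S)
        closed′ y∈ carries = ∈-remove⁺ (closed (proj₁ (∈-remove⁻ y∈)) carries)
          λ { refl → proj₂ (firstChildless-sound S (map t S) first)
                           (Any.map⁺ (lose (proj₁ (∈-remove⁻ y∈)) carries)) }
      ... | nothing = subst (λ S → EncodesTree S []) (sym (firstChildless-nothing S first)) encodesTree-[]

  mutual
    encode-cong : ∀ {t t′ : Fin n → V} → t ≗ t′ → ∀ f S → Tree.encode t f S ≡ Tree.encode t′ f S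
    encode-cong t≗t′ zero    S = refl
    encode-cong t≗t′ (suc f) S = trans (cong (Tree.encodeStep _ f S ∘ firstChildless S) (map-cong t≗t′ S))
                                        (encodeStep-cong t≗t′ f S _)

    encodeStep-cong : ∀ {t t′ : Fin n → V} → t ≗ t′ →
      ∀ f S x → Tree.encodeStep t f S x ≡ Tree.encodeStep t′ f S x
    encodeStep-cong t≗t′ f S nothing  = refl
    encodeStep-cong t≗t′ f S (just x) = cong (x ∷_) (encode-cong t≗t′ f (remove x S))

-- Bijections and set partitions

module _ {a b ℓ₁ ℓ₂} (S : Setoid a ℓ₁) (T : Setoid b ℓ₂) where
  private
    module S = Setoid S
    module T = Setoid T

  mkInverse : (to : S.Carrier → T.Carrier) (from : T.Carrier → S.Carrier) →
              (∀ {x y} → x S.≈ y → to x T.≈ to y) → (∀ {x y} → x T.≈ y → from x S.≈ from y) →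
              (∀ y → to (from y) T.≈ y) → (∀ x → from (to x) S.≈ x) → Inverse S T
  mkInverse to from to-cong from-cong to∘from from∘to = record
    { to        = to
    ; from      = from
    ; to-cong   = to-cong
    ; from-cong = from-cong
    ; inverse   = strictlyInverseˡ⇒inverseˡ S T to-cong to∘from
                , strictlyInverseʳ⇒inverseʳ S T from-cong from∘to
    }

module _ {n k : ℕ} where

  blocks : (Fin n → Fin k) → Fin k → Subset n
  blocks t b = Vec.tabulate (λ ℓ → does (t ℓ Fin.≟ b))

  lookup-blocks : ∀ t b ℓ → Vec.lookup (blocks t b) ℓ ≡ does (t ℓ Fin.≟ b)
  lookup-blocks t b = Vec.lookup∘tabulate (λ ℓ → does (t ℓ Fin.≟ b))

  ∈-blocks⁻ : ∀ t {ℓ b} → ℓ ∈ₛ blocks t b → t ℓ ≡ b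
  ∈-blocks⁻ t {ℓ} {b} ℓ∈ with t ℓ Fin.≟ b | trans (sym (lookup-blocks t b ℓ)) (Vec.[]=⇒lookup ℓ∈)
  ... | yes tℓ≡b | _ = tℓ≡b

  ∈-blocks⁺ : ∀ t ℓ → ℓ ∈ₛ blocks t (t ℓ)
  ∈-blocks⁺ t ℓ = Vec.lookup⇒[]= ℓ _ (trans (lookup-blocks t (t ℓ) ℓ) (dec-true (t ℓ Fin.≟ t ℓ) refl))

  blocks-isSetPartition : ∀ t → IsSetPartition n k (blocks t)
  blocks-isSetPartition t ℓ =
    (t ℓ , ∈-blocks⁺ t ℓ) , λ b b′ ℓ∈b ℓ∈b′ → trans (sym (∈-blocks⁻ t ℓ∈b)) (∈-blocks⁻ t ℓ∈b′)

  ∣blocks∣ : ∀ t b → ∣ blocks t b ∣ ≡ valueCount t b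
  ∣blocks∣ t b = ∣tabulate∣≡count (λ ℓ → does (t ℓ Fin.≟ b))

  blockOf : UB n k → Fin n → Fin k
  blockOf Π ℓ = proj₁ (proj₁ (proj₂ Π ℓ))

  blockOf-unique : ∀ (Π : UB n k) {ℓ b} → ℓ ∈ₛ proj₁ Π b → blockOf Π ℓ ≡ b
  blockOf-unique Π {ℓ} ℓ∈b = proj₂ (proj₂ Π ℓ) _ _ (proj₂ (proj₁ (proj₂ Π ℓ))) ℓ∈b

  does-blockOf : ∀ (Π : UB n k) b ℓ → does (blockOf Π ℓ Fin.≟ b) ≡ Vec.lookup (proj₁ Π b) ℓ
  does-blockOf Π b ℓ with Vec.lookup (proj₁ Π b) ℓ in lookup-ℓ
  ... | true  = dec-true (blockOf Π ℓ Fin.≟ b) (blockOf-unique Π (Vec.lookup⇒[]= ℓ (proj₁ Π b) lookup-ℓ))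
  ... | false = dec-false (blockOf Π ℓ Fin.≟ b) λ { refl →
      case trans (sym (Vec.[]=⇒lookup (proj₂ (proj₁ (proj₂ Π ℓ))))) lookup-ℓ of λ () }

  UB↔targets : Inverse (UB-setoid n k) (Fin n →-setoid Fin k)
  UB↔targets = mkInverse (UB-setoid n k) (Fin n →-setoid Fin k)
    blockOf
    (λ t → blocks t , blocks-isSetPartition t)
    (λ {Π} {Π′} Π≈Π′ ℓ →
       sym (blockOf-unique Π′ (subst (ℓ ∈ₛ_) (Π≈Π′ (blockOf Π ℓ)) (proj₂ (proj₁ (proj₂ Π ℓ))))))
    (λ t≗t′ b → Vec.tabulate-cong (λ ℓ → cong (λ x → does (x Fin.≟ b)) (t≗t′ ℓ)))
    (λ t ℓ → blockOf-unique (blocks t , blocks-isSetPartition t) (∈-blocks⁺ t ℓ))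
    (λ Π b → trans (Vec.tabulate-cong (does-blockOf Π b)) (Vec.tabulate∘lookup (proj₁ Π b)))

-- Labelled graphs

module LabelledGraphs (n : ℕ) (m : Fin n → ℕ) (m≥1 : ∀ i → 1 ≤ m i) where

  k : ℕ
  k = kOf n m

  K : ℕ
  K = totalM n m ∸ n

  word : Fin K → Fin n
  word = proj₁ (sortedWord n m m≥1)

  word-monotone : Monotone word
  word-monotone = proj₁ (proj₂ (sortedWord n m m≥1))

  valueCount-word : ∀ ℓ → valueCount word ℓ ≡ m ℓ ∸ 1
  valueCount-word = proj₂ (proj₂ (sortedWord n m m≥1))

  word-notSymbol : ∀ j → m (word j) ≢ 1
  word-notSymbol j m≡1
    with () ← subst (1 ≤_) (trans (valueCount-word (word j)) (cong (_∸ 1) m≡1)) (valueCount-self word j)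

  outLabel : Fin k → Fin k → Maybe (Fin n)
  outLabel r v with r Fin.≟ v
  ... | yes _   = nothing
  ... | no r≢v = just (word (punchOut r≢v))

  outLabel-root : ∀ r → outLabel r r ≡ nothing
  outLabel-root r with r Fin.≟ r
  ... | yes _   = refl
  ... | no r≢r = ⊥-elim (r≢r refl)

  outLabel-punchIn : ∀ r j → outLabel r (punchIn r j) ≡ just (word j)
  outLabel-punchIn r j with r Fin.≟ punchIn r j
  ... | yes r≡ = ⊥-elim (Fin.punchInᵢ≢i r j (sym r≡))
  ... | no r≢  = cong (just ∘ word) (trans (Fin.punchOut-cong r refl) (Fin.punchOut-punchIn r))

  outLabel-nothing : ∀ {r v} → outLabel r v ≡ nothing → v ≡ r
  outLabel-nothing {r} {v} eq with r Fin.≟ v | eq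
  ... | yes r≡v | _ = sym r≡v

  outLabel-just : ∀ {r v ℓ} → outLabel r v ≡ just ℓ → ∃ λ j → v ≡ punchIn r j × word j ≡ ℓ
  outLabel-just {r} {v} eq with r Fin.≟ v | eq
  ... | no r≢v | refl = punchOut r≢v , sym (Fin.punchIn-punchOut r≢v) , refl

  outLabel-≢ : ∀ {r v} → r ≢ v → ∃ λ ℓ → outLabel r v ≡ just ℓ
  outLabel-≢ {r} {v} r≢v with r Fin.≟ v
  ... | yes r≡v = ⊥-elim (r≢v r≡v)
  ... | no _    = _ , refl

  outLabel-notSymbol : ∀ {r v ℓ} → outLabel r v ≡ just ℓ → m ℓ ≢ 1
  outLabel-notSymbol eq with outLabel-just eq
  ... | j , _ , refl = word-notSymbol j

  graph : Fin k → (Fin n → Fin k) → Out n m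
  graph r t (inj₁ v)       = Maybe.map (λ ℓ → inj₁ (t ℓ) , ℓ) (outLabel r v)
  graph r t (inj₂ (i , _)) = just (inj₁ (t i) , i)

  graph-root : ∀ r t → graph r t (inj₁ r) ≡ nothing
  graph-root r t = cong (Maybe.map _) (outLabel-root r)

  graph-outLabel : ∀ r t {a ℓ} → outLabel r a ≡ just ℓ → graph r t (inj₁ a) ≡ just (inj₁ (t ℓ) , ℓ)
  graph-outLabel r t eq = cong (Maybe.map _) eq

  graph-outLabel⁻ : ∀ r t {a w ℓ} → graph r t (inj₁ a) ≡ just (w , ℓ) → outLabel r a ≡ just ℓ
  graph-outLabel⁻ r t {a} eq with outLabel r a | eq
  ... | just _ | refl = refl

  graph-nothing : ∀ r t {a} → outLabel r a ≡ nothing → graph r t (inj₁ a) ≡ nothing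
  graph-nothing r t eq = cong (Maybe.map _) eq

  graph-target : ∀ r t {u w ℓ} → graph r t u ≡ just (w , ℓ) → w ≡ inj₁ (t ℓ)
  graph-target r t {inj₂ _} refl = refl
  graph-target r t {inj₁ a} eq with outLabel r a | eq
  ... | just _ | refl = refl

  graph-cong : ∀ r {t t′} → t ≗ t′ → ∀ v → graph r t v ≡ graph r t′ v
  graph-cong r t≗t′ (inj₂ (i , _)) = cong (λ x → just (inj₁ x , i)) (t≗t′ i)
  graph-cong r t≗t′ (inj₁ a) with outLabel r a
  ... | nothing = refl
  ... | just ℓ  = cong (λ x → just (inj₁ x , ℓ)) (t≗t′ ℓ)

  SymbolEdges : Out n m → Set
  SymbolEdges out = ∀ (i : SymIdx n m) → ∃ λ w → out (inj₂ i) ≡ just (w , proj₁ i)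

  isSymbol : Fin n → ℕ
  isSymbol ℓ = bit (does (m ℓ ℕ.≟ 1))

  reqCount≡ : ∀ ℓ → reqCount (m ℓ) ≡ (m ℓ ∸ 1) + isSymbol ℓ
  reqCount≡ ℓ with m ℓ | m≥1 ℓ
  ... | suc zero    | _ = refl
  ... | suc (suc a) | _ = sym (ℕ.+-identityʳ (suc a))

  reqCount-pos : ∀ ℓ → 1 ≤ reqCount (m ℓ)
  reqCount-pos ℓ with m ℓ | m≥1 ℓ
  ... | suc zero    | _ = s≤s z≤n
  ... | suc (suc _) | _ = s≤s z≤n

  symbolLabelled? : ∀ ℓ i → Dec (i ≡ ℓ × m i ≡ 1)
  symbolLabelled? ℓ i = (i Fin.≟ ℓ) ×-dec (m i ℕ.≟ 1)

  length-filter-symList : ∀ ℓ xs → length (filter (λ i → proj₁ i Fin.≟ ℓ) (symList n m xs))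
                                 ≡ length (filter (symbolLabelled? ℓ) xs)
  length-filter-symList ℓ []       = refl
  length-filter-symList ℓ (i ∷ xs) with m i ℕ.≟ 1
  ... | yes mi≡1 = begin
    length (filter (λ i → proj₁ i Fin.≟ ℓ) ((i , mi≡1) ∷ symList n m xs))
      ≡⟨ length-filter-∷ (λ i → proj₁ i Fin.≟ ℓ) (i , mi≡1) (symList n m xs) ⟩
    bit (does (i Fin.≟ ℓ)) + length (filter (λ i → proj₁ i Fin.≟ ℓ) (symList n m xs))
      ≡⟨ cong₂ (λ b c → bit b + c) (sym (does-symbolLabelled?)) (length-filter-symList ℓ xs) ⟩
    bit (does (symbolLabelled? ℓ i)) + length (filter (symbolLabelled? ℓ) xs)
      ≡⟨ length-filter-∷ (symbolLabelled? ℓ) i xs ⟨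
    length (filter (symbolLabelled? ℓ) (i ∷ xs)) ∎
    where
    open ≡-Reasoning
    does-symbolLabelled? : does (symbolLabelled? ℓ i) ≡ does (i Fin.≟ ℓ)
    does-symbolLabelled? = trans (cong (does (i Fin.≟ ℓ) ∧_) (dec-true (m i ℕ.≟ 1) mi≡1)) (∧-identityʳ _)
  ... | no mi≢1 = begin
    length (filter (λ i → proj₁ i Fin.≟ ℓ) (symList n m xs))
      ≡⟨ length-filter-symList ℓ xs ⟩
    length (filter (symbolLabelled? ℓ) xs)
      ≡⟨ cong (λ b → bit b + length (filter (symbolLabelled? ℓ) xs)) does-symbolLabelled? ⟨
    bit (does (symbolLabelled? ℓ i)) + length (filter (symbolLabelled? ℓ) xs)
      ≡⟨ length-filter-∷ (symbolLabelled? ℓ) i xs ⟨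
    length (filter (symbolLabelled? ℓ) (i ∷ xs)) ∎
    where
    open ≡-Reasoning
    does-symbolLabelled? : does (symbolLabelled? ℓ i) ≡ false
    does-symbolLabelled? = trans (cong (does (i Fin.≟ ℓ) ∧_) (dec-false (m i ℕ.≟ 1) mi≢1)) (∧-zeroʳ _)

  edgeCount-rooted : ∀ out r (w : Fin K → Fin n) → out (inj₁ r) ≡ nothing →
    (∀ j → ∃ λ x → out (inj₁ (punchIn r j)) ≡ just (x , w j)) → SymbolEdges out →
    ∀ ℓ → edgeCount n m out ℓ ≡ valueCount w ℓ + isSymbol ℓ
  edgeCount-rooted out r w root-edge labelled symbol-edges ℓ = begin
    edgeCount n m out ℓ
      ≡⟨ cong length (filter-++ P? (map inj₁ (allFin k)) (map inj₂ symbols)) ⟩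
    length (filter P? (map inj₁ (allFin k)) ++ filter P? (map inj₂ symbols))
      ≡⟨ length-++ (filter P? (map inj₁ (allFin k))) ⟩
    length (filter P? (map inj₁ (allFin k))) + length (filter P? (map inj₂ symbols))
      ≡⟨ cong₂ _+_ (length-filter-map P? inj₁ (allFin k)) (length-filter-map P? inj₂ symbols) ⟩
    length (filter (P? ∘ inj₁) (allFin k)) + length (filter (P? ∘ inj₂) symbols)
      ≡⟨ cong₂ _+_ integerPart symbolPart ⟩
    valueCount w ℓ + isSymbol ℓ ∎
    where
    open ≡-Reasoning
    P? = λ v → hasLabel? n m ℓ (out v)
    symbols = symList n m (allFin n)
    integerPart : length (filter (P? ∘ inj₁) (allFin k)) ≡ valueCount w ℓ
    integerPart = begin
      length (filter (P? ∘ inj₁) (allFin k))                  ≡⟨ length-filter-allFin (P? ∘ inj₁) ⟩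
      count (does ∘ P? ∘ inj₁)                                ≡⟨ count-removeAt r (does ∘ P? ∘ inj₁) ⟩
      bit (does (P? (inj₁ r))) + count (does ∘ P? ∘ inj₁ ∘ punchIn r)
        ≡⟨ cong₂ _+_ (cong (bit ∘ does ∘ hasLabel? n m ℓ) root-edge)
                     (count-cong λ j → cong (does ∘ hasLabel? n m ℓ) (proj₂ (labelled j))) ⟩
      valueCount w ℓ                                         ∎
    symbolPart : length (filter (P? ∘ inj₂) symbols) ≡ isSymbol ℓ
    symbolPart = begin
      length (filter (P? ∘ inj₂) symbols)
        ≡⟨ cong length (filter-≐ (P? ∘ inj₂) (λ i → proj₁ i Fin.≟ ℓ) (labelled-ℓ , ℓ-labelled) symbols) ⟩
      length (filter (λ i → proj₁ i Fin.≟ ℓ) symbols)        ≡⟨ length-filter-symList ℓ (allFin n) ⟩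
      length (filter (symbolLabelled? ℓ) (allFin n))          ≡⟨ length-filter-allFin (symbolLabelled? ℓ) ⟩
      count (λ i → does (i Fin.≟ ℓ) ∧ does (m i ℕ.≟ 1))      ≡⟨ count-only ℓ (λ i → does (m i ℕ.≟ 1)) ⟩
      isSymbol ℓ                                             ∎
      where
      labelled-ℓ : ∀ {i} → HasLabel n m ℓ (out (inj₂ i)) → proj₁ i ≡ ℓ
      labelled-ℓ {i} has with symbol-edges i
      ... | _ , eq rewrite eq = has
      ℓ-labelled : ∀ {i} → proj₁ i ≡ ℓ → HasLabel n m ℓ (out (inj₂ i))
      ℓ-labelled {i} i≡ℓ with symbol-edges i
      ... | _ , eq rewrite eq = i≡ℓ

  graph-labeling : ∀ r t → Labeling n m (graph r t)
  graph-labeling r t = record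
    { cond2     = λ v i → mk⇔ (λ { refl → symbol-leaf i , _ , refl }) (leaf-symbol v i)
    ; cond3-cnt = λ ℓ → begin
        edgeCount n m (graph r t) ℓ
          ≡⟨ edgeCount-rooted (graph r t) r word (graph-root r t)
               (λ j → _ , graph-outLabel r t (outLabel-punchIn r j)) (λ i → _ , refl) ℓ ⟩
        valueCount word ℓ + isSymbol ℓ ≡⟨ cong (_+ isSymbol ℓ) (valueCount-word ℓ) ⟩
        (m ℓ ∸ 1) + isSymbol ℓ         ≡⟨ reqCount≡ ℓ ⟨
        reqCount (m ℓ)                 ∎
    ; cond3-sib = λ v v′ w w′ ℓ e e′ → trans (graph-target r t {v} e) (sym (graph-target r t {v′} e′))
    ; cond4     = monotone-labels
    }
    where
    open ≡-Reasoning
    symbol-leaf : ∀ i → IsLeaf n m (graph r t) (inj₂ i)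
    symbol-leaf i u ℓ e with () ← graph-target r t {u} e
    leaf-symbol : ∀ v (i : SymIdx n m) →
      IsLeaf n m (graph r t) v × (∃ λ w → Edge n m (graph r t) v w (proj₁ i)) → v ≡ inj₂ i
    leaf-symbol (inj₁ a)          (i , mi≡1) (_ , _ , e)    = ⊥-elim (outLabel-notSymbol (graph-outLabel⁻ r t e) mi≡1)
    leaf-symbol (inj₂ (i , p)) (.i , q)     (_ , _ , refl) = cong (λ p → inj₂ (i , p)) (ℕ.≡-irrelevant p q)
    monotone-labels : ∀ a b w w′ e₁ e₂ →
      Edge n m (graph r t) (inj₁ a) w e₁ → Edge n m (graph r t) (inj₁ b) w′ e₂ →
      e₁ ≢ e₂ → (e₁ Fin.< e₂) ⇔ (a Fin.< b)
    monotone-labels a b w w′ e₁ e₂ ea eb e₁≢e₂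
      with outLabel-just (graph-outLabel⁻ r t ea) | outLabel-just (graph-outLabel⁻ r t eb)
    ... | i , refl , refl | j , refl , refl = mk⇔ to from
      where
      to : word i Fin.< word j → punchIn r i Fin.< punchIn r j
      to wi<wj with Fin.<-cmp i j
      ... | tri< i<j _ _ = punchIn-< r i<j
      ... | tri≈ _ i≡j _ = ⊥-elim (e₁≢e₂ (cong word i≡j))
      ... | tri> _ _ j<i = ⊥-elim (ℕ.<⇒≱ wi<wj (word-monotone (ℕ.<⇒≤ j<i)))
      from : punchIn r i Fin.< punchIn r j → word i Fin.< word j
      from r-i<r-j = Fin.≤∧≢⇒< (word-monotone (Fin.punchIn-cancel-≤ r i j (ℕ.<⇒≤ r-i<r-j))) e₁≢e₂

  module _ {out : Out n m} (labeling : Labeling n m out) where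
    open Labeling labeling

    symbol-isLeaf : ∀ i → IsLeaf n m out (inj₂ i)
    symbol-isLeaf i = proj₁ (Equivalence.to (cond2 (inj₂ i) i) refl)

    symbolEdges : SymbolEdges out
    symbolEdges i = proj₂ (Equivalence.to (cond2 (inj₂ i) i) refl)

    labelled-edge : ∀ ℓ → ∃ λ v → v ∈ allVtx n m × ∃ λ x → out v ≡ just (inj₁ x , ℓ)
    labelled-edge ℓ with filter-nonempty (λ v → hasLabel? n m ℓ (out v)) (allVtx n m)
                           (subst (1 ≤_) (sym (cond3-cnt ℓ)) (reqCount-pos ℓ))
    ... | v , v∈ , has-ℓ with out v in out-v | has-ℓ
    ...   | just (inj₁ x , _) | refl = v , v∈ , x , out-v
    ...   | just (inj₂ i , _) | refl = ⊥-elim (symbol-isLeaf i v ℓ out-v)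

    target : Fin n → Fin k
    target ℓ = proj₁ (proj₂ (proj₂ (labelled-edge ℓ)))

    target-witness : ∀ ℓ → ∃ λ v → v ∈ allVtx n m × out v ≡ just (inj₁ (target ℓ) , ℓ)
    target-witness ℓ = let v , v∈ , _ , e = labelled-edge ℓ in v , v∈ , e

    target-spec : ∀ {v w ℓ} → out v ≡ just (w , ℓ) → w ≡ inj₁ (target ℓ)
    target-spec {v} {w} {ℓ} e = let v′ , _ , e′ = target-witness ℓ in cond3-sib v v′ w _ ℓ e e′

    inLabelCount≡valueCount-target : ∀ i → inLabelCount n m out (inj₁ i) ≡ valueCount target i
    inLabelCount≡valueCount-target i = begin
      inLabelCount n m out (inj₁ i)
        ≡⟨ cong length (filter-≐ _ (λ ℓ → target ℓ Fin.≟ i) (to , from) (allFin n)) ⟩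
      length (filter (λ ℓ → target ℓ Fin.≟ i) (allFin n))
        ≡⟨ length-filter-allFin (λ ℓ → target ℓ Fin.≟ i) ⟩
      valueCount target i ∎
      where
      open ≡-Reasoning
      to : ∀ {ℓ} → Any (λ v → out v ≡ just (inj₁ i , ℓ)) (allVtx n m) → target ℓ ≡ i
      to edge = let _ , _ , e = find edge in sym (Sum.inj₁-injective (target-spec e))
      from : ∀ {ℓ} → target ℓ ≡ i → Any (λ v → out v ≡ just (inj₁ i , ℓ)) (allVtx n m)
      from {ℓ} refl = let _ , v∈ , e = target-witness ℓ in lose v∈ e

    module _ (r : Fin k) (root-edge : out (inj₁ r) ≡ nothing)
             (has-edge : ∀ v → v ≢ inj₁ r → ∃ λ e → out v ≡ just e) where

      labelWord : Fin K → Fin n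
      labelWord j = proj₂ (proj₁ (has-edge (inj₁ (punchIn r j)) (Fin.punchInᵢ≢i r j ∘ Sum.inj₁-injective)))

      labelWord-edge : ∀ j → out (inj₁ (punchIn r j)) ≡ just (inj₁ (target (labelWord j)) , labelWord j)
      labelWord-edge j with has-edge (inj₁ (punchIn r j)) (Fin.punchInᵢ≢i r j ∘ Sum.inj₁-injective)
      ... | (w , ℓ) , e = trans e (cong (λ w → just (w , ℓ)) (target-spec e))

      labelWord-monotone : Monotone labelWord
      labelWord-monotone {i} {j} i≤j with labelWord i Fin.≟ labelWord j
      ... | yes eq = ℕ.≤-reflexive (cong toℕ eq)
      ... | no neq with Fin.<-cmp i j
      ...   | tri< i<j _ _ = ℕ.<⇒≤ (Equivalence.from (cond4 _ _ _ _ _ _ (labelWord-edge i) (labelWord-edge j) neq)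
                                                 (punchIn-< r i<j))
      ...   | tri≈ _ i≡j _ = ⊥-elim (neq (cong labelWord i≡j))
      ...   | tri> _ _ j<i = ⊥-elim (ℕ.<⇒≱ j<i i≤j)

      valueCount-labelWord : ∀ ℓ → valueCount labelWord ℓ ≡ m ℓ ∸ 1
      valueCount-labelWord ℓ = ℕ.+-cancelʳ-≡ (isSymbol ℓ) _ _ (begin
        valueCount labelWord ℓ + isSymbol ℓ
          ≡⟨ edgeCount-rooted out r labelWord root-edge (λ j → _ , labelWord-edge j) symbolEdges ℓ ⟨
        edgeCount n m out ℓ                 ≡⟨ cond3-cnt ℓ ⟩
        reqCount (m ℓ)                      ≡⟨ reqCount≡ ℓ ⟩
        (m ℓ ∸ 1) + isSymbol ℓ              ∎)
        where open ≡-Reasoning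

      labelWord≗word : labelWord ≗ word
      labelWord≗word = monotone-unique labelWord-monotone word-monotone
        λ ℓ → trans (valueCount-labelWord ℓ) (sym (valueCount-word ℓ))

      graph-characterisation : ∀ v → out v ≡ graph r target v
      graph-characterisation (inj₂ i) with symbolEdges i
      ... | w , e = trans e (cong (λ w → just (w , proj₁ i)) (target-spec e))
      graph-characterisation (inj₁ a) with a Fin.≟ r
      ... | yes refl = trans root-edge (sym (graph-root r target))
      ... | no a≢r = subst (λ a → out (inj₁ a) ≡ graph r target (inj₁ a)) (Fin.punchIn-punchOut r≢a) (begin
          out (inj₁ (punchIn r j))                          ≡⟨ labelWord-edge j ⟩
          just (inj₁ (target (labelWord j)) , labelWord j)  ≡⟨ cong (λ ℓ → just (inj₁ (target ℓ) , ℓ)) (labelWord≗word j) ⟩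
          just (inj₁ (target (word j)) , word j)            ≡⟨ graph-outLabel r target (outLabel-punchIn r j) ⟨
          graph r target (inj₁ (punchIn r j))               ∎)
        where
        open ≡-Reasoning
        r≢a = a≢r ∘ sym
        j = punchOut r≢a

  target-graph : ∀ r t → target (graph-labeling r t) ≗ t
  target-graph r t ℓ =
    let v , _ , e = target-witness (graph-labeling r t) ℓ in Sum.inj₁-injective (graph-target r t {v} e)

  target-cong : ∀ {out out′} (L : Labeling n m out) (L′ : Labeling n m out′) →
    (∀ v → out v ≡ out′ v) → target L ≗ target L′
  target-cong L L′ out≈ ℓ =
    let v , _ , e = target-witness L′ ℓ in sym (Sum.inj₁-injective (target-spec L (trans (out≈ v) e)))

  graph-isUG : ∀ t → IsUGGraph n m (graph zero t)
  graph-isUG t = graph-root zero t , λ where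
    (inj₂ _) _    → _ , refl
    (inj₁ a) a≢0 → _ , graph-outLabel zero t (proj₂ (outLabel-≢ (a≢0 ∘ cong inj₁ ∘ sym)))

  UG↔targets : Inverse (UG-setoid n m) (Fin n →-setoid Fin k)
  UG↔targets = mkInverse (UG-setoid n m) (Fin n →-setoid Fin k)
    (λ G → target (proj₂ (proj₂ G)))
    (λ t → graph zero t , graph-isUG t , graph-labeling zero t)
    (λ {G} {G′} → target-cong (proj₂ (proj₂ G)) (proj₂ (proj₂ G′)))
    (graph-cong zero)
    (λ t → target-graph zero t)
    (λ (out , (root-edge , has-edge) , labeling) v → sym (graph-characterisation labeling zero root-edge has-edge v))

  open Prüfer using (module Tree)

  IsTree : Fin k → (Fin n → Fin k) → Set
  IsTree r t = ∀ ℓ → Tree.ReachesRoot (outLabel r) t ℓ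

  graph-Reaches-target : ∀ r t {ℓ} → Tree.ReachesRoot (outLabel r) t ℓ → Reaches n m (graph r t) (inj₁ (t ℓ))
  graph-Reaches-target r t (Tree.root none) = here (graph-nothing r t none)
  graph-Reaches-target r t (Tree.up some p) = step (graph-outLabel r t some) (graph-Reaches-target r t p)

  graph-Reaches-target⁻ : ∀ r t {v} → Reaches n m (graph r t) v →
    ∀ ℓ → v ≡ inj₁ (t ℓ) → Tree.ReachesRoot (outLabel r) t ℓ
  graph-Reaches-target⁻ r t (here none) ℓ refl with outLabel r (t ℓ) in label-tℓ
  ... | nothing = Tree.root label-tℓ
  ... | just _  = case none of λ ()
  graph-Reaches-target⁻ r t (step {ℓ = ℓ′} edge rest) ℓ refl =
    Tree.up (graph-outLabel⁻ r t edge) (graph-Reaches-target⁻ r t rest ℓ′ (graph-target r t {inj₁ (t ℓ)} edge))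

  graph-nothing⁻ : ∀ r t v → graph r t v ≡ nothing → v ≡ inj₁ r
  graph-nothing⁻ r t (inj₁ a) none with outLabel r a in label-a
  ... | nothing = cong inj₁ (outLabel-nothing label-a)

  graph-isRootedTree : ∀ r t → IsTree r t → IsRootedTree n m (graph r t)
  graph-isRootedTree r t tree =
    reaches , λ u v u-root v-root → trans (graph-nothing⁻ r t u u-root) (sym (graph-nothing⁻ r t v v-root))
    where
    reaches : ∀ v → Reaches n m (graph r t) v
    reaches (inj₂ (i , _)) = step refl (graph-Reaches-target r t (tree i))
    reaches (inj₁ a) with outLabel r a in label-a
    ... | nothing = here (graph-nothing r t label-a)
    ... | just ℓ  = step (graph-outLabel r t label-a) (graph-Reaches-target r t (tree ℓ))

  Reaches-resp : ∀ {out out′} → (∀ v → out v ≡ out′ v) → ∀ {v} → Reaches n m out v → Reaches n m out′ v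
  Reaches-resp out≈ (here none)     = here (trans (sym (out≈ _)) none)
  Reaches-resp out≈ (step edge rest) = step (trans (sym (out≈ _)) edge) (Reaches-resp out≈ rest)

  RootedTree : Set
  RootedTree = Σ (Fin k × (Fin n → Fin k)) λ (r , t) → IsTree r t

  RootedTree-setoid : Setoid 0ℓ 0ℓ
  RootedTree-setoid = On.setoid (setoid (Fin k) ×ₛ (Fin n →-setoid Fin k)) (λ (T : RootedTree) → proj₁ T)

  module _ (T : UT n m) where
    private
      out = proj₁ T
      reaches = proj₁ (proj₁ (proj₂ T))
      labeling = proj₂ (proj₂ T)

    UT-root : ∃ λ r → out (inj₁ r) ≡ nothing
    UT-root = endpoint (reaches (inj₁ zero))
      where
      endpoint : ∀ {v} → Reaches n m out v → ∃ λ r → out (inj₁ r) ≡ nothing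
      endpoint (here {inj₁ r} none) = r , none
      endpoint (here {inj₂ i} none) with () ← trans (sym none) (proj₂ (symbolEdges labeling i))
      endpoint (step _ rest) = endpoint rest

    nonroot-edge : ∀ v → v ≢ inj₁ (proj₁ UT-root) → ∃ λ e → out v ≡ just e
    nonroot-edge v v≢root with out v in out-v
    ... | just e  = e , refl
    ... | nothing = ⊥-elim (v≢root (proj₂ (proj₁ (proj₂ T)) v (inj₁ (proj₁ UT-root)) out-v (proj₂ UT-root)))

    UT-characterisation : ∀ v → out v ≡ graph (proj₁ UT-root) (target labeling) v
    UT-characterisation = graph-characterisation labeling (proj₁ UT-root) (proj₂ UT-root) nonroot-edge

    UT-isTree : IsTree (proj₁ UT-root) (target labeling)
    UT-isTree ℓ = graph-Reaches-target⁻ (proj₁ UT-root) (target labeling)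
                    (Reaches-resp UT-characterisation (reaches _)) ℓ refl

  UT-root-cong : ∀ T T′ → (∀ v → proj₁ T v ≡ proj₁ T′ v) → proj₁ (UT-root T) ≡ proj₁ (UT-root T′)
  UT-root-cong T T′ T≈T′ = Sum.inj₁-injective (proj₂ (proj₁ (proj₂ T)) _ _ (proj₂ (UT-root T))
                                                 (trans (T≈T′ _) (proj₂ (UT-root T′))))

  treeGraph : RootedTree → UT n m
  treeGraph ((r , t) , tree) = graph r t , graph-isRootedTree r t tree , graph-labeling r t

  UT-root-treeGraph : ∀ T → proj₁ (UT-root (treeGraph T)) ≡ proj₁ (proj₁ T)
  UT-root-treeGraph T@((r , t) , _) = Sum.inj₁-injective (graph-nothing⁻ r t _ (proj₂ (UT-root (treeGraph T))))

  UT↔RootedTree : Inverse (UT-setoid n m) RootedTree-setoid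
  UT↔RootedTree = mkInverse (UT-setoid n m) RootedTree-setoid
    (λ T → (proj₁ (UT-root T) , target (proj₂ (proj₂ T))) , UT-isTree T)
    treeGraph
    (λ {T} {T′} T≈T′ → UT-root-cong T T′ T≈T′ , target-cong (proj₂ (proj₂ T)) (proj₂ (proj₂ T′)) T≈T′)
    (λ { {(r , t) , _} {(.r , t′) , _} (refl , t≗t′) → graph-cong r t≗t′ })
    (λ T@((r , t) , _) → UT-root-treeGraph T , target-graph r t)
    (λ T v → sym (UT-characterisation T v))

  -- The empty code only occurs for n = 0, when zero is the only vertex.
  codeRoot : List (Fin k) → Fin k
  codeRoot cs with initLast cs
  ... | []       = zero
  ... | _ ∷ʳ′ c = c

  codeRoot-∷ʳ : ∀ {cs} init c → cs ≡ init ∷ʳ c → codeRoot cs ≡ c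
  codeRoot-∷ʳ {cs} init c cs≡ with initLast cs
  codeRoot-∷ʳ []      c () | []
  codeRoot-∷ʳ (_ ∷ _) c () | []
  ... | init′ ∷ʳ′ c′ = ∷ʳ-injectiveʳ init′ init cs≡

  -- A vertex other than 0 would index a letter of word, a word over Fin 0.
  single-vertex : n ≡ 0 → ∀ (a : Fin k) → a ≡ zero
  single-vertex n≡0 zero    = refl
  single-vertex refl (suc a) with () ← word a

  validCode : ∀ cs → length cs ≡ n → Prüfer.ValidCode (outLabel (codeRoot cs)) (allFin n) cs
  validCode cs |cs|≡n = record
    { unique     = allFin⁺ n
    ; length≡    = trans |cs|≡n (sym (length-tabulate id))
    ; endsAtRoot = endsAtRoot cs
    ; labels∈    = λ _ _ → ∈-allFin _
    }
    where
    endsAtRoot : ∀ cs → Prüfer.EndsAtRoot (outLabel (codeRoot cs)) cs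
    endsAtRoot cs with initLast cs
    ... | []          = inj₁ refl
    ... | init ∷ʳ′ c = inj₂ (init , c , refl , outLabel-root c)

  module _ (r : Fin k) (t : Fin n → Fin k) where
    open Prüfer (outLabel r) hiding (module Tree)
    open Prüfer.Tree (outLabel r) t

    prüferOrder : List (Fin n)
    prüferOrder = encode n (allFin n)

    prüferCode : Fin n → Fin k
    prüferCode s = lookupOr zero (map t prüferOrder) (toℕ s)

    prüferOrder-encodesTree : IsTree r t → EncodesTree (allFin n) prüferOrder
    prüferOrder-encodesTree tree = encode-encodesTree tree n (allFin n) (allFin⁺ n) (λ _ _ → ∈-allFin _)
      (ℕ.≤-reflexive (length-tabulate id))

    module _ (tree : IsTree r t) where
      open EncodesTree (prüferOrder-encodesTree tree)
      open Enumerates enumerates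

      length-prüferCode : length (map t prüferOrder) ≡ n
      length-prüferCode = trans (length-map t prüferOrder) (trans length≡ (length-tabulate id))

      tabulate-prüferCode : tabulate prüferCode ≡ map t prüferOrder
      tabulate-prüferCode = tabulate-lookupOr zero (map t prüferOrder) length-prüferCode

      valueCount-prüferCode : ∀ j → valueCount prüferCode j ≡ valueCount t j
      valueCount-prüferCode j = begin
        valueCount prüferCode j
          ≡⟨ length-filter-tabulate (Fin._≟ j) prüferCode ⟨
        length (filter (Fin._≟ j) (tabulate prüferCode))
          ≡⟨ cong (length ∘ filter (Fin._≟ j)) tabulate-prüferCode ⟩
        length (filter (Fin._≟ j) (map t prüferOrder))
          ≡⟨ length-filter-map (Fin._≟ j) t prüferOrder ⟩
        length (filter ((Fin._≟ j) ∘ t) prüferOrder)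
          ≡⟨ length-filter-enumeration ((Fin._≟ j) ∘ t) unique (λ x → proj₂ sameElements (∈-allFin x)) ⟩
        length (filter ((Fin._≟ j) ∘ t) (allFin n))
          ≡⟨ length-filter-allFin ((Fin._≟ j) ∘ t) ⟩
        valueCount t j ∎
        where open ≡-Reasoning

      codeRoot-prüferCode : codeRoot (map t prüferOrder) ≡ r
      codeRoot-prüferCode with endsAtRoot
      ... | inj₂ (init , c , eq , root-label) = trans (codeRoot-∷ʳ init c eq) (outLabel-nothing root-label)
      ... | inj₁ empty = trans (single-vertex n≡0 _) (sym (single-vertex n≡0 r))
        where n≡0 = trans (sym length-prüferCode) (cong length empty)

  decodedOrder : List (Fin k) → List (Fin n)
  decodedOrder cs = Prüfer.decode (outLabel (codeRoot cs)) (allFin n) cs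

  decodedTargets : List (Fin k) → Fin n → Fin k
  decodedTargets cs = assoc (decodedOrder cs) cs zero

  decodedOrder-prüferCode : ∀ r t (tree : IsTree r t) → decodedOrder (map t (prüferOrder r t)) ≡ prüferOrder r t
  decodedOrder-prüferCode r t tree rewrite codeRoot-prüferCode r t tree =
    Prüfer.Tree.EncodesTree.decode-code (prüferOrder-encodesTree r t tree)

  decodedTargets-prüferCode : ∀ r t (tree : IsTree r t) → decodedTargets (map t (prüferOrder r t)) ≗ t
  decodedTargets-prüferCode r t tree x rewrite decodedOrder-prüferCode r t tree =
    assoc-map t (prüferOrder r t) zero unique (proj₂ sameElements (∈-allFin x))
    where open Prüfer.Enumerates (Prüfer.Tree.EncodesTree.enumerates (prüferOrder-encodesTree r t tree))

  module _ (cs : List (Fin k)) (|cs|≡n : length cs ≡ n) where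
    private
      valid = validCode cs |cs|≡n
      open Prüfer (outLabel (codeRoot cs)) hiding (module Tree)
      open Prüfer.Tree (outLabel (codeRoot cs)) (decodedTargets cs)
      open Enumerates (decode-enumerates (allFin n) cs valid)

    map-decodedTargets : map (decodedTargets cs) (decodedOrder cs) ≡ cs
    map-decodedTargets = map-assoc (decodedOrder cs) cs zero unique (trans length≡ (sym (Prüfer.ValidCode.length≡ valid)))

    decoded-isTree : IsTree (codeRoot cs) (decodedTargets cs)
    decoded-isTree ℓ =
      decode-reachesRoot (allFin n) cs valid map-decodedTargets (proj₂ sameElements (∈-allFin ℓ))

    prüferCode-decoded : map (decodedTargets cs) (prüferOrder (codeRoot cs) (decodedTargets cs)) ≡ cs
    prüferCode-decoded = trans
      (cong (map (decodedTargets cs))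
            (encode-decode (allFin n) cs valid map-decodedTargets n (ℕ.≤-reflexive (length-tabulate id))))
      map-decodedTargets

  prüferCode-cong : ∀ r {t t′} → t ≗ t′ → prüferCode r t ≗ prüferCode r t′
  prüferCode-cong r {t} {t′} t≗t′ s = cong (λ cs → lookupOr zero cs (toℕ s))
    (trans (map-cong t≗t′ (prüferOrder r t)) (cong (map t′) (Prüfer.encode-cong (outLabel r) t≗t′ n (allFin n))))

  decodedTree : (Fin n → Fin k) → RootedTree
  decodedTree c = (codeRoot (tabulate c) , decodedTargets (tabulate c)) , decoded-isTree (tabulate c) (length-tabulate c)

  RootedTree↔codes : Inverse RootedTree-setoid (Fin n →-setoid Fin k)
  RootedTree↔codes = mkInverse RootedTree-setoid (Fin n →-setoid Fin k)
    (λ ((r , t) , _) → prüferCode r t)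
    decodedTree
    (λ { {(r , _) , _} {(.r , _) , _} (refl , t≗t′) → prüferCode-cong r t≗t′ })
    (λ c≗c′ → let eq = tabulate-cong c≗c′ in cong codeRoot eq , λ x → cong (λ cs → decodedTargets cs x) eq)
    (λ c s → trans (cong (λ cs → lookupOr zero cs (toℕ s)) (prüferCode-decoded (tabulate c) (length-tabulate c)))
                   (lookupOr-tabulate zero c s))
    (λ ((r , t) , tree) → trans (cong codeRoot (tabulate-prüferCode r t tree)) (codeRoot-prüferCode r t tree)
                        , λ x → trans (cong (λ cs → decodedTargets cs x) (tabulate-prüferCode r t tree))
                                      (decodedTargets-prüferCode r t tree x))

  ψ₁ : Bijection (UT-setoid n m) (UG-setoid n m)
  ψ₁ = Inverse⇒Bijection
    (Compose.inverse (Compose.inverse UT↔RootedTree RootedTree↔codes) (Symmetry.inverse UG↔targets))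

  ψ₂ : Bijection (UG-setoid n m) (UB-setoid n k)
  ψ₂ = Inverse⇒Bijection (Compose.inverse UG↔targets (Symmetry.inverse UB↔targets))

  inLabelCount-ψ₁ : ∀ T i →
    inLabelCount n m (proj₁ T) (inj₁ i) ≡ inLabelCount n m (proj₁ (Bijection.to ψ₁ T)) (inj₁ i)
  inLabelCount-ψ₁ T i = begin
    inLabelCount n m (proj₁ T) (inj₁ i)       ≡⟨ inLabelCount≡valueCount-target labeling i ⟩
    valueCount t i                            ≡⟨ valueCount-prüferCode r t (UT-isTree T) i ⟨
    valueCount (prüferCode r t) i             ≡⟨ valueCount-cong (target-graph zero (prüferCode r t)) i ⟨
    valueCount (target (graph-labeling zero (prüferCode r t))) i
      ≡⟨ inLabelCount≡valueCount-target (graph-labeling zero (prüferCode r t)) i ⟨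
    inLabelCount n m (proj₁ (Bijection.to ψ₁ T)) (inj₁ i) ∎
    where
    open ≡-Reasoning
    labeling = proj₂ (proj₂ T)
    r = proj₁ (UT-root T)
    t = target labeling

  inLabelCount-ψ₂ : ∀ G i → inLabelCount n m (proj₁ G) (inj₁ i) ≡ ∣ proj₁ (Bijection.to ψ₂ G) i ∣
  inLabelCount-ψ₂ G i =
    trans (inLabelCount≡valueCount-target (proj₂ (proj₂ G)) i) (sym (∣blocks∣ (target (proj₂ (proj₂ G))) i))

theorem3p2 : (n : ℕ) (m : Fin n → ℕ) → (∀ i → 1 ≤ m i) →
    Σ (Bijection (UT-setoid n m) (UG-setoid n m)) λ ψ₁ →
    Σ (Bijection (UG-setoid n m) (UB-setoid n (kOf n m))) λ ψ₂ →
    ∀ (T : UT n m) (i : Fin (kOf n m)) →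
    (inLabelCount n m (proj₁ T) (inj₁ i)
    ≡ inLabelCount n m (proj₁ (Bijection.to ψ₁ T)) (inj₁ i))
    × (inLabelCount n m (proj₁ (Bijection.to ψ₁ T)) (inj₁ i)
    ≡ ∣ proj₁ (Bijection.to ψ₂ (Bijection.to ψ₁ T)) i ∣)
theorem3p2 n m m≥1 = ψ₁ , ψ₂ , λ T i → inLabelCount-ψ₁ T i , inLabelCount-ψ₂ (Bijection.to ψ₁ T) i
  where open LabelledGraphs n m m≥1
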